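{- In a core instance, for every $t\in T$, $$g(t)=l(e)-\sum_{j'\in J'}h(I_{j'},t)-\max\Big\{p^*-\Big(\Big|\bigcup_{i\in[\kappa]}I^*_i\Big|-\sum_{i\in[\kappa]}h(I^*_i,t)\Big),\,0\Big\}.$$
   Context: Core instance: one event $e$ of length $l(e)$ (scheduled at $t$ it occupies $\mathrm{st}(e,t)=\{t,\dots,t+l(e)-1\}$) and one agent whose job set is $\{j^*\}\cup J'$. Job $j^*$ is a multi-interval job with processing time $p^*$ and job intervals $I^*_1,\dots,I^*_\kappa$ (sets of time slots); it must be processed in $p^*$ distinct slots of $\bigcup_i I^*_i$. Each $j'\in J'$ is a rigid job occupying all slots of its interval $I_{j'}$. All these intervals are pairwise disjoint, and the job set admits a feasible schedule (at most one job per slot). $g(t)$ is the maximum, over feasible job schedules, of the number of slots of $\mathrm{st}(e,t)$ in which no job is processed. For $S\subseteq T$, $h(S,t)=|S\cap\mathrm{st}(e,t)|$. -}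

module Defs where

open import Data.Nat using (ℕ; zero; suc; _+_; _≤_; _<_; _≤?_; _<?_)
open import Data.List using (List; length; filter; concat)
open import Data.Vec using (Vec; lookup)
open import Data.Fin using (Fin)
open import Data.Maybe using (Maybe; just; nothing; is-nothing)
open import Data.Bool using (if_then_else_)
open import Data.Product using (Σ; ∃; _×_)
open import Data.List.Relation.Unary.Unique.Propositional using (Unique)
open import Data.List.Membership.Propositional using (_∈_)
open import Relation.Binary.PropositionalEquality using (_≡_)
open import Relation.Nullary.Decidable using (_×-dec_)
open import Function.Bundles using (_⇔_)

-- Time slots are natural numbers; a set of slots is a duplicate-free list.
-- Jobs of the single agent: the multi-interval job j* and m rigid jobs.
data Job (m : ℕ) : Set where
  jstar : Job m
  rigid : Fin m → Job m

Schedule : ℕ → Set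
Schedule m = ℕ → Maybe (Job m)

Feasible : (m p : ℕ) → List (List ℕ) → Vec (List ℕ) m → Schedule m → Set
Feasible m p Istar Irigid σ =
  (∀ k s → s ∈ lookup Irigid k → σ s ≡ just (rigid k)) ×
  (∀ k s → σ s ≡ just (rigid k) → s ∈ lookup Irigid k) ×
  Σ (List ℕ) (λ L → Unique L × length L ≡ p ×
     (∀ s → (σ s ≡ just jstar) ⇔ (s ∈ L)) ×
     (∀ s → s ∈ L → s ∈ concat Istar))

-- h(S,t) = |S ∩ st(e,t)| with st(e,t) = {t, …, t+l-1}; S duplicate-free.
h : (l : ℕ) → List ℕ → ℕ → ℕ
h l S t = length (filter (λ s → (t ≤? s) ×-dec (s <? t + l)) S)

idle : ∀ {m} → Schedule m → (t l : ℕ) → ℕ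
idle σ t zero = 0
idle σ t (suc l) = (if is-nothing (σ t) then 1 else 0) + idle σ (suc t) l

-- "g(t) = v": v is the maximum, over feasible schedules, of the number of
-- idle slots in st(e,t).
IsG : (l m p : ℕ) → List (List ℕ) → Vec (List ℕ) m → ℕ → ℕ → Set
IsG l m p Istar Irigid t v =
  (∃ λ σ → Feasible m p Istar Irigid σ × idle σ t l ≡ v) ×
  (∀ σ → Feasible m p Istar Irigid σ → idle σ t l ≤ v)

{-# OPTIONS --safe #-}
module Submission where

-- Every slot of st(e,t) is idle, occupied by a rigid job, or used by j*, so a feasible
-- schedule whose j*-slots form the set L has exactly l - Σ h(I_j′,t) - h(L,t) idle slots
-- there. Maximising idleness thus means minimising h(L,t) over the p*-element subsets L of
-- U = ⋃ I*_i. At most |U| - h(U,t) elements of L lie outside the window, so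
-- h(L,t) ≥ p* ∸ (|U| - h(U,t)); choosing the slots of U outside the window first attains
-- this bound. The truncated subtraction p* ∸ … is the max{…, 0} of the statement.

open import Defs
open import Level using (Level)
open import Function using (id; _∘_; _⇔_; mk⇔; Equivalence)
open import Data.Nat
  using (ℕ; zero; suc; _+_; _*_; _∸_; _⊓_; _≤_; _<_; _≤?_; _<?_; _≟_; z≤n; s≤s; z<s)
open import Data.Nat.Properties
open import Data.Nat.ListAction using (sum)
open import Algebra.Properties.CommutativeSemigroup +-commutativeSemigroup using (interchange)
open import Data.Bool using (Bool; true; false; if_then_else_)
open import Data.Maybe using (just; nothing; is-nothing)
open import Data.Product using (∃; _×_; _,_; proj₁; proj₂)
open import Data.Sum using (inj₁; inj₂; [_,_]′)
open import Data.Fin using () renaming (zero to fzero; suc to fsuc)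
open import Data.Fin.Properties using (any?)
open import Data.List using (List; []; _∷_; length; concat; map; _++_; filter; take)
open import Data.List.Properties
  using (length-++; filter-++; filter-all; filter-none; length-take; take++drop≡id)
import Data.List.Relation.Unary.All as All
import Data.List.Relation.Unary.All.Properties as All
open import Data.List.Relation.Unary.Any using (here; there)
open import Data.List.Relation.Unary.Unique.Propositional using (Unique; []; _∷_)
import Data.List.Relation.Unary.Unique.Propositional.Properties as Unique
open import Data.List.Relation.Binary.Disjoint.Propositional using (Disjoint)
open import Data.List.Relation.Binary.Subset.Propositional using (_⊆_)
open import Data.List.Relation.Binary.Subset.Propositional.Properties using (filter-⊆; filter⁺′)
open import Data.List.Relation.Binary.Permutation.Propositional.Properties using (↭-length; shift)
open import Data.List.Membership.Propositional using (_∈_; _∉_)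
open import Data.List.Membership.Propositional.Properties
  using (∈-++⁺ˡ; ∈-++⁺ʳ; ∈-++⁻; ∈-∃++; ∈-filter⁻; ∈-concat⁺′; ∈-concat⁻)
open import Data.List.Membership.DecPropositional _≟_ using (_∈?_)
open import Data.Vec using (Vec; toList; lookup) renaming (_∷_ to _∷ᵛ_)
import Data.Vec.Relation.Unary.Any as VecAny
import Data.Vec.Relation.Unary.Any.Properties as VecAny
open import Data.Vec.Membership.Propositional.Properties using (∈-lookup; ∈-toList⁺)
open import Relation.Nullary using (yes; no; does; contradiction)
open import Relation.Nullary.Decidable using (_×-dec_; dec-true; dec-false; does-⇔)
open import Relation.Unary using (Pred; Decidable)
open import Relation.Unary.Properties using (∁?)
open import Relation.Binary.PropositionalEquality
  using (_≡_; _≢_; refl; sym; trans; cong; cong₂; subst; module ≡-Reasoning)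

private
  variable
    a ℓ : Level
    A : Set a

𝟙 : Bool → ℕ
𝟙 b = if b then 1 else 0

Unique-++⁻ : ∀ (xs : List A) {ys} → Unique (xs ++ ys) → Unique xs × Unique ys × Disjoint xs ys
Unique-++⁻ []       u        = [] , u , λ ()
Unique-++⁻ (x ∷ xs) (x∉ ∷ u) with Unique-++⁻ xs u
... | uxs , uys , xs∩ys=∅ = All.++⁻ˡ xs x∉ ∷ uxs , uys , x∷xs∩ys=∅
  where
  x∷xs∩ys=∅ : Disjoint (x ∷ xs) _
  x∷xs∩ys=∅ (here refl  , v∈ys) = All.lookup x∉ (∈-++⁺ʳ xs v∈ys) refl
  x∷xs∩ys=∅ (there v∈xs , v∈ys) = xs∩ys=∅ (v∈xs , v∈ys)

Unique∧⊆⇒length≤ : {xs ys : List A} → Unique xs → xs ⊆ ys → length xs ≤ length ys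
Unique∧⊆⇒length≤ {xs = []}     _          _        = z≤n
Unique∧⊆⇒length≤ {xs = x ∷ xs} (x∉xs ∷ u) x∷xs⊆ys with ∈-∃++ (x∷xs⊆ys (here refl))
... | us , vs , refl = begin
    suc (length xs)         ≤⟨ s≤s (Unique∧⊆⇒length≤ u xs⊆us++vs) ⟩
    suc (length (us ++ vs)) ≡⟨ ↭-length (shift x us vs) ⟨
    length (us ++ x ∷ vs)   ∎
  where
  open ≤-Reasoning
  xs⊆us++vs : xs ⊆ us ++ vs
  xs⊆us++vs y∈xs with ∈-++⁻ us (x∷xs⊆ys (there y∈xs))
  ... | inj₁ y∈us         = ∈-++⁺ˡ y∈us
  ... | inj₂ (here refl)  = contradiction refl (All.lookup x∉xs y∈xs)
  ... | inj₂ (there y∈vs) = ∈-++⁺ʳ us y∈vs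

take-⊆ : ∀ n (xs : List A) → take n xs ⊆ xs
take-⊆ n xs x∈ = subst (_ ∈_) (take++drop≡id n xs) (∈-++⁺ˡ x∈)

take-++ : ∀ n (xs ys : List A) → take n (xs ++ ys) ≡ take n xs ++ take (n ∸ length xs) ys
take-++ zero    xs       ys = cong (λ k → take k ys) (sym (0∸n≡0 (length xs)))
take-++ (suc n) []       ys = refl
take-++ (suc n) (x ∷ xs) ys = cong (x ∷_) (take-++ n xs ys)

module _ {P : Pred A ℓ} (P? : Decidable P) where

  length-filter-∷ : ∀ x xs →
    length (filter P? (x ∷ xs)) ≡ 𝟙 (does (P? x)) + length (filter P? xs)
  length-filter-∷ x xs with does (P? x)
  ... | true  = refl
  ... | false = refl

  length-filter-++ : ∀ xs ys →
    length (filter P? (xs ++ ys)) ≡ length (filter P? xs) + length (filter P? ys)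
  length-filter-++ xs ys = trans (cong length (filter-++ P? xs ys)) (length-++ (filter P? xs))

  length-filter-∁+length-filter : ∀ xs →
    length (filter (∁? P?) xs) + length (filter P? xs) ≡ length xs
  length-filter-∁+length-filter []       = refl
  length-filter-∁+length-filter (x ∷ xs) with does (P? x)
  ... | true  = trans (+-suc _ _) (cong suc (length-filter-∁+length-filter xs))
  ... | false = cong suc (length-filter-∁+length-filter xs)

  length-filter-∁ : ∀ xs → length (filter (∁? P?) xs) ≡ length xs ∸ length (filter P? xs)
  length-filter-∁ xs =
    trans (sym (m+n∸n≡m (length (filter (∁? P?) xs)) (length (filter P? xs))))
          (cong (_∸ length (filter P? xs)) (length-filter-∁+length-filter xs))

  length-filter-lowerBound : ∀ {xs ys} → Unique xs → xs ⊆ ys →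
    length xs ∸ (length ys ∸ length (filter P? ys)) ≤ length (filter P? xs)
  length-filter-lowerBound {xs} {ys} uxs xs⊆ys = m≤n+o⇒m∸n≤o (length xs) _ (begin
      length xs                           ≡⟨ length-filter-∁+length-filter xs ⟨
      outside xs + inside xs              ≤⟨ +-monoˡ-≤ (inside xs) outside-mono ⟩
      outside ys + inside xs              ≡⟨ cong (_+ inside xs) (length-filter-∁ ys) ⟩
      (length ys ∸ inside ys) + inside xs ∎)
    where
    open ≤-Reasoning
    inside outside : List A → ℕ
    inside zs  = length (filter P? zs)
    outside zs = length (filter (∁? P?) zs)
    outside-mono : outside xs ≤ outside ys
    outside-mono = Unique∧⊆⇒length≤ (Unique.filter⁺ (∁? P?) {xs} uxs)
                                    (filter⁺′ (∁? P?) (∁? P?) id xs⊆ys)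

  takeAvoiding : ℕ → List A → List A
  takeAvoiding n xs = take n (filter (∁? P?) xs ++ filter P? xs)

  takeAvoiding-⊆ : ∀ n xs → takeAvoiding n xs ⊆ xs
  takeAvoiding-⊆ n xs x∈ =
    [ filter-⊆ (∁? P?) xs , filter-⊆ P? xs ]′ (∈-++⁻ (filter (∁? P?) xs) (take-⊆ n _ x∈))

  takeAvoiding-Unique : ∀ n {xs} → Unique xs → Unique (takeAvoiding n xs)
  takeAvoiding-Unique n {xs} uxs = Unique.take⁺ n
    (Unique.++⁺ (Unique.filter⁺ (∁? P?) {xs} uxs) (Unique.filter⁺ P? {xs} uxs)
      (λ (v∈∁ , v∈P) → proj₂ (∈-filter⁻ (∁? P?) {xs = xs} v∈∁)
                             (proj₂ (∈-filter⁻ P? {xs = xs} v∈P))))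

  length-takeAvoiding : ∀ {n} xs → n ≤ length xs → length (takeAvoiding n xs) ≡ n
  length-takeAvoiding {n} xs n≤∣xs∣ = begin
    length (takeAvoiding n xs)                               ≡⟨ length-take n _ ⟩
    n ⊓ length (filter (∁? P?) xs ++ filter P? xs)           ≡⟨ cong (n ⊓_) (length-++ (filter (∁? P?) xs)) ⟩
    n ⊓ (length (filter (∁? P?) xs) + length (filter P? xs)) ≡⟨ m≤n⇒m⊓n≡m n≤∣∁∣+∣P∣ ⟩
    n                                                        ∎
    where
    open ≡-Reasoning
    n≤∣∁∣+∣P∣ : n ≤ length (filter (∁? P?) xs) + length (filter P? xs)
    n≤∣∁∣+∣P∣ = subst (n ≤_) (sym (length-filter-∁+length-filter xs)) n≤∣xs∣

  length-filter-takeAvoiding : ∀ {n} xs → n ≤ length xs →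
    length (filter P? (takeAvoiding n xs)) ≡ n ∸ (length xs ∸ length (filter P? xs))
  length-filter-takeAvoiding {n} xs n≤∣xs∣ = begin
    length (filter P? (take n (outside ++ inside)))       ≡⟨ cong (length ∘ filter P?) (take-++ n outside inside) ⟩
    length (filter P? (take n outside ++ take k inside))  ≡⟨ length-filter-++ (take n outside) _ ⟩
    length (filter P? (take n outside)) + length (filter P? (take k inside))
      ≡⟨ cong₂ (λ ys zs → length ys + length zs)
           (filter-none P? (All.take⁺ n (All.all-filter (∁? P?) xs)))
           (filter-all P? (All.take⁺ k (All.all-filter P? xs))) ⟩
    length (take k inside)                                ≡⟨ length-take k inside ⟩
    k ⊓ length inside                                     ≡⟨ m≤n⇒m⊓n≡m k≤∣inside∣ ⟩
    k                                                     ≡⟨ cong (n ∸_) (length-filter-∁ xs) ⟩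
    n ∸ (length xs ∸ length (filter P? xs))               ∎
    where
    open ≡-Reasoning
    outside inside : List A
    outside = filter (∁? P?) xs
    inside  = filter P? xs
    k : ℕ
    k = n ∸ length outside
    k≤∣inside∣ : k ≤ length inside
    k≤∣inside∣ = m≤n+o⇒m∸n≤o n (length outside)
      (subst (n ≤_) (sym (length-filter-∁+length-filter xs)) n≤∣xs∣)

∈-concat-toList⁺ : ∀ {n} (v : Vec (List A) n) k {x} → x ∈ lookup v k → x ∈ concat (toList v)
∈-concat-toList⁺ v k x∈vₖ = ∈-concat⁺′ x∈vₖ (∈-toList⁺ (∈-lookup k v))

∈-concat-toList⁻ : ∀ {n} (v : Vec (List A) n) {x} →
  x ∈ concat (toList v) → ∃ λ k → x ∈ lookup v k
∈-concat-toList⁻ v {x} x∈ = VecAny.index x∈vₖ , VecAny.lookup-index x∈vₖ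
  where
  x∈vₖ : VecAny.Any (x ∈_) v
  x∈vₖ = VecAny.toList⁻ (∈-concat⁻ (toList v) x∈)

Unique-concat⇒index-unique : ∀ {n} (v : Vec (List A) n) → Unique (concat (toList v)) →
  ∀ {x} k k′ → x ∈ lookup v k → x ∈ lookup v k′ → k ≡ k′
Unique-concat⇒index-unique (xs ∷ᵛ v) u fzero fzero _ _ = refl
Unique-concat⇒index-unique (xs ∷ᵛ v) u fzero (fsuc k′) x∈xs x∈vₖ′ =
  contradiction (x∈xs , ∈-concat-toList⁺ v k′ x∈vₖ′) (proj₂ (proj₂ (Unique-++⁻ xs u)))
Unique-concat⇒index-unique (xs ∷ᵛ v) u (fsuc k) fzero x∈vₖ x∈xs =
  contradiction (x∈xs , ∈-concat-toList⁺ v k x∈vₖ) (proj₂ (proj₂ (Unique-++⁻ xs u)))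
Unique-concat⇒index-unique (xs ∷ᵛ v) u (fsuc k) (fsuc k′) x∈vₖ x∈vₖ′ =
  cong fsuc (Unique-concat⇒index-unique v (proj₁ (proj₂ (Unique-++⁻ xs u))) k k′ x∈vₖ x∈vₖ′)

χ : List ℕ → ℕ → ℕ
χ S s = 𝟙 (does (s ∈? S))

χ-∈ : ∀ {S s} → s ∈ S → χ S s ≡ 1
χ-∈ {S} {s} s∈S = cong 𝟙 (dec-true (s ∈? S) s∈S)

χ-∉ : ∀ {S s} → s ∉ S → χ S s ≡ 0
χ-∉ {S} {s} s∉S = cong 𝟙 (dec-false (s ∈? S) s∉S)

χ-∷ : ∀ {x S} → x ∉ S → ∀ s → χ (x ∷ S) s ≡ 𝟙 (does (s ≟ x)) + χ S s
χ-∷ {x} {S} x∉S s with s ≟ x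
... | yes refl = begin
  χ (x ∷ S) x               ≡⟨ χ-∈ {x ∷ S} (here refl) ⟩
  1                         ≡⟨ cong₂ (λ b n → 𝟙 b + n) (dec-true (x ≟ x) refl) (χ-∉ x∉S) ⟨
  𝟙 (does (x ≟ x)) + χ S x ∎
  where open ≡-Reasoning
... | no s≢x = begin
  χ (x ∷ S) s               ≡⟨ cong 𝟙 (does-⇔ (mk⇔ ∈-tail there) (s ∈? x ∷ S) (s ∈? S)) ⟩
  χ S s                     ≡⟨ cong (λ b → 𝟙 b + χ S s) (dec-false (s ≟ x) s≢x) ⟨
  𝟙 (does (s ≟ x)) + χ S s ∎
  where
  open ≡-Reasoning
  ∈-tail : s ∈ x ∷ S → s ∈ S
  ∈-tail (here s≡x)  = contradiction s≡x s≢x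
  ∈-tail (there s∈S) = s∈S

InWindow : ℕ → ℕ → Pred ℕ _
InWindow l t s = t ≤ s × s < t + l

inWindow? : ∀ l t → Decidable (InWindow l t)
inWindow? l t s = (t ≤? s) ×-dec (s <? t + l)

windowSum : (ℕ → ℕ) → ℕ → ℕ → ℕ
windowSum f t zero    = 0
windowSum f t (suc l) = f t + windowSum f (suc t) l

windowSum-cong : ∀ {f g} → (∀ s → f s ≡ g s) → ∀ t l → windowSum f t l ≡ windowSum g t l
windowSum-cong f≗g t zero    = refl
windowSum-cong f≗g t (suc l) = cong₂ _+_ (f≗g t) (windowSum-cong f≗g (suc t) l)

windowSum-+ : ∀ f g t l →
  windowSum (λ s → f s + g s) t l ≡ windowSum f t l + windowSum g t l
windowSum-+ f g t zero    = refl
windowSum-+ f g t (suc l) = trans (cong (f t + g t +_) (windowSum-+ f g (suc t) l))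
                                  (interchange (f t) (g t) _ _)

windowSum-const : ∀ c t l → windowSum (λ _ → c) t l ≡ l * c
windowSum-const c t zero    = refl
windowSum-const c t (suc l) = cong (c +_) (windowSum-const c (suc t) l)

windowSum-indicator : ∀ x t l →
  windowSum (λ s → 𝟙 (does (s ≟ x))) t l ≡ 𝟙 (does (inWindow? l t x))
windowSum-indicator x t zero = cong 𝟙 (sym (dec-false (inWindow? 0 t x)
  (λ (t≤x , x<t+0) → ≤⇒≯ t≤x (subst (x <_) (+-identityʳ t) x<t+0))))
windowSum-indicator x t (suc l) with t ≟ x
... | yes refl = begin
  𝟙 (does (t ≟ t)) + windowSum (λ s → 𝟙 (does (s ≟ t))) (suc t) l
    ≡⟨ cong₂ (λ b n → 𝟙 b + n) (dec-true (t ≟ t) refl) (windowSum-indicator t (suc t) l) ⟩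
  1 + 𝟙 (does (inWindow? l (suc t) t))
    ≡⟨ cong (λ b → 1 + 𝟙 b) (dec-false (inWindow? l (suc t) t) (λ (t<t , _) → <-irrefl refl t<t)) ⟩
  1
    ≡⟨ cong 𝟙 (dec-true (inWindow? (suc l) t t) (≤-refl , m<m+n t z<s)) ⟨
  𝟙 (does (inWindow? (suc l) t t))
    ∎
  where open ≡-Reasoning
... | no t≢x = begin
  𝟙 (does (t ≟ x)) + windowSum (λ s → 𝟙 (does (s ≟ x))) (suc t) l
    ≡⟨ cong₂ (λ b n → 𝟙 b + n) (dec-false (t ≟ x) t≢x) (windowSum-indicator x (suc t) l) ⟩
  𝟙 (does (inWindow? l (suc t) x))
    ≡⟨ cong 𝟙 (does-⇔ (mk⇔ shrink grow) (inWindow? l (suc t) x) (inWindow? (suc l) t x)) ⟩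
  𝟙 (does (inWindow? (suc l) t x))
    ∎
  where
  open ≡-Reasoning
  shrink : InWindow l (suc t) x → InWindow (suc l) t x
  shrink (t<x , x<1+t+l) = <⇒≤ t<x , subst (x <_) (sym (+-suc t l)) x<1+t+l
  grow : InWindow (suc l) t x → InWindow l (suc t) x
  grow (t≤x , x<t+1+l) = ≤∧≢⇒< t≤x t≢x , subst (x <_) (+-suc t l) x<t+1+l

h≡windowSum-χ : ∀ l t {S} → Unique S → h l S t ≡ windowSum (χ S) t l
h≡windowSum-χ l t {[]}    []        = sym (trans (windowSum-const 0 t l) (*-zeroʳ l))
h≡windowSum-χ l t {x ∷ S} (x∉S ∷ u) = begin
  h l (x ∷ S) t
    ≡⟨ length-filter-∷ (inWindow? l t) x S ⟩
  𝟙 (does (inWindow? l t x)) + h l S t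
    ≡⟨ cong₂ _+_ (sym (windowSum-indicator x t l)) (h≡windowSum-χ l t u) ⟩
  windowSum (λ s → 𝟙 (does (s ≟ x))) t l + windowSum (χ S) t l
    ≡⟨ windowSum-+ _ (χ S) t l ⟨
  windowSum (λ s → 𝟙 (does (s ≟ x)) + χ S s) t l
    ≡⟨ windowSum-cong (λ s → sym (χ-∷ (Unique.Unique[x∷xs]⇒x∉xs (x∉S ∷ u)) s)) t l ⟩
  windowSum (χ (x ∷ S)) t l
    ∎
  where open ≡-Reasoning

idle≡windowSum : ∀ {m} (σ : Schedule m) t l →
  idle σ t l ≡ windowSum (λ s → 𝟙 (is-nothing (σ s))) t l
idle≡windowSum σ t zero    = refl
idle≡windowSum σ t (suc l) = cong (𝟙 (is-nothing (σ t)) +_) (idle≡windowSum σ (suc t) l)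

sum-map-h : ∀ l t xss → sum (map (λ I → h l I t) xss) ≡ h l (concat xss) t
sum-map-h l t []         = refl
sum-map-h l t (xs ∷ xss) = trans (cong (h l xs t +_) (sum-map-h l t xss))
                                 (sym (length-filter-++ (inWindow? l t) xs (concat xss)))

module _ {m} (Irigid : Vec (List ℕ) m) (σ : Schedule m) (L : List ℕ)
  (rigid-sound : ∀ k s → s ∈ lookup Irigid k → σ s ≡ just (rigid k))
  (rigid-complete : ∀ k s → σ s ≡ just (rigid k) → s ∈ lookup Irigid k)
  (jstar-iff : ∀ s → (σ s ≡ just jstar) ⇔ (s ∈ L)) where

  private
    R : List ℕ
    R = concat (toList Irigid)

    s∉R : ∀ {s o} → σ s ≡ o → (∀ k → o ≢ just (rigid k)) → s ∉ R
    s∉R {s} σs≡o o≢rigid s∈R with ∈-concat-toList⁻ Irigid s∈R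
    ... | k , s∈Iₖ = o≢rigid k (trans (sym σs≡o) (rigid-sound k s s∈Iₖ))

    s∉L : ∀ {s o} → σ s ≡ o → o ≢ just jstar → s ∉ L
    s∉L {s} σs≡o o≢jstar s∈L = o≢jstar (trans (sym σs≡o) (Equivalence.from (jstar-iff s) s∈L))

  slot-partition : ∀ s → 𝟙 (is-nothing (σ s)) + (χ R s + χ L s) ≡ 1
  slot-partition s with σ s in eq
  ... | nothing        = cong suc (cong₂ _+_ (χ-∉ (s∉R eq λ _ ())) (χ-∉ (s∉L eq λ ())))
  ... | just jstar     =
    cong₂ _+_ (χ-∉ (s∉R eq λ _ ())) (χ-∈ (Equivalence.to (jstar-iff s) eq))
  ... | just (rigid k) =
    cong₂ _+_ (χ-∈ (∈-concat-toList⁺ Irigid k (rigid-complete k s eq))) (χ-∉ (s∉L eq λ ()))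

  idle+h+h≡l : Unique R → Unique L → ∀ t l → idle σ t l + (h l R t + h l L t) ≡ l
  idle+h+h≡l uR uL t l = begin
    idle σ t l + (h l R t + h l L t)
      ≡⟨ cong₂ _+_ (idle≡windowSum σ t l) (cong₂ _+_ (h≡windowSum-χ l t uR) (h≡windowSum-χ l t uL)) ⟩
    windowSum isIdle t l + (windowSum (χ R) t l + windowSum (χ L) t l)
      ≡⟨ cong (windowSum isIdle t l +_) (windowSum-+ (χ R) (χ L) t l) ⟨
    windowSum isIdle t l + windowSum (λ s → χ R s + χ L s) t l
      ≡⟨ windowSum-+ isIdle _ t l ⟨
    windowSum (λ s → isIdle s + (χ R s + χ L s)) t l  ≡⟨ windowSum-cong slot-partition t l ⟩
    windowSum (λ _ → 1) t l                            ≡⟨ windowSum-const 1 t l ⟩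
    l * 1                                              ≡⟨ *-identityʳ l ⟩
    l                                                  ∎
    where
    open ≡-Reasoning
    isIdle : ℕ → ℕ
    isIdle s = 𝟙 (is-nothing (σ s))

  idle≡l∸h∸h : Unique R → Unique L → ∀ t l → idle σ t l ≡ l ∸ h l R t ∸ h l L t
  idle≡l∸h∸h uR uL t l = begin
    idle σ t l                ≡⟨ m+n∸n≡m (idle σ t l) busy ⟨
    idle σ t l + busy ∸ busy  ≡⟨ cong (_∸ busy) (idle+h+h≡l uR uL t l) ⟩
    l ∸ (h l R t + h l L t)   ≡⟨ ∸-+-assoc l (h l R t) (h l L t) ⟨
    l ∸ h l R t ∸ h l L t     ∎
    where
    open ≡-Reasoning
    busy : ℕ
    busy = h l R t + h l L t

module _ {m} (Irigid : Vec (List ℕ) m) (L : List ℕ) where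

  schedule : Schedule m
  schedule s with any? (λ k → s ∈? lookup Irigid k) | s ∈? L
  ... | yes (k , _) | _     = just (rigid k)
  ... | no _        | yes _ = just jstar
  ... | no _        | no _  = nothing

  schedule-rigid-sound : Unique (concat (toList Irigid)) →
    ∀ k s → s ∈ lookup Irigid k → schedule s ≡ just (rigid k)
  schedule-rigid-sound uR k s s∈Iₖ with any? (λ k → s ∈? lookup Irigid k) | s ∈? L
  ... | yes (k′ , s∈Iₖ′) | _ =
    cong (just ∘ rigid) (Unique-concat⇒index-unique Irigid uR k′ k s∈Iₖ′ s∈Iₖ)
  ... | no ∄k            | _ = contradiction (k , s∈Iₖ) ∄k

  schedule-rigid-complete : ∀ k s → schedule s ≡ just (rigid k) → s ∈ lookup Irigid k
  schedule-rigid-complete k s with any? (λ k → s ∈? lookup Irigid k) | s ∈? L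
  ... | yes (k′ , s∈Iₖ′) | _     = λ { refl → s∈Iₖ′ }
  ... | no _             | yes _ = λ ()
  ... | no _             | no _  = λ ()

  schedule-jstar : Disjoint L (concat (toList Irigid)) →
    ∀ s → (schedule s ≡ just jstar) ⇔ (s ∈ L)
  schedule-jstar L∩R=∅ s with any? (λ k → s ∈? lookup Irigid k) | s ∈? L
  ... | yes (k , s∈Iₖ) | _       =
    mk⇔ (λ ()) (λ s∈L → contradiction (s∈L , ∈-concat-toList⁺ Irigid k s∈Iₖ) L∩R=∅)
  ... | no _           | yes s∈L = mk⇔ (λ _ → s∈L) (λ _ → refl)
  ... | no _           | no s∉L  = mk⇔ (λ ()) (λ s∈L → contradiction s∈L s∉L)

module _ (l p : ℕ) {m} (Istar : List (List ℕ)) (Irigid : Vec (List ℕ) m)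
  (unique-slots : Unique (concat Istar ++ concat (toList Irigid))) (t : ℕ) where

  private
    U R : List ℕ
    U = concat Istar
    R = concat (toList Irigid)

    uU : Unique U
    uU = proj₁ (Unique-++⁻ U unique-slots)

    uR : Unique R
    uR = proj₁ (proj₂ (Unique-++⁻ U unique-slots))

    U∩R=∅ : Disjoint U R
    U∩R=∅ = proj₂ (proj₂ (Unique-++⁻ U unique-slots))

  idle-upper-bound : ∀ σ → Feasible m p Istar Irigid σ →
    idle σ t l ≤ l ∸ h l R t ∸ (p ∸ (length U ∸ h l U t))
  idle-upper-bound σ (sound , complete , L , uL , ∣L∣≡p , jstar-iff , L⊆U) = begin
    idle σ t l                               ≡⟨ idle≡l∸h∸h Irigid σ L sound complete jstar-iff uR uL t l ⟩
    l ∸ h l R t ∸ h l L t                    ≤⟨ ∸-monoʳ-≤ (l ∸ h l R t) few-outside ⟩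
    l ∸ h l R t ∸ (p ∸ (length U ∸ h l U t)) ∎
    where
    open ≤-Reasoning
    few-outside : p ∸ (length U ∸ h l U t) ≤ h l L t
    few-outside = subst (λ n → n ∸ (length U ∸ h l U t) ≤ h l L t) ∣L∣≡p
      (length-filter-lowerBound (inWindow? l t) uL (L⊆U _))

  idle-attained : p ≤ length U → ∃ λ σ → Feasible m p Istar Irigid σ ×
    idle σ t l ≡ l ∸ h l R t ∸ (p ∸ (length U ∸ h l U t))
  idle-attained p≤∣U∣ =
    σ , (sound , complete , L , uL , length-takeAvoiding _ U p≤∣U∣ , jstar-iff , L⊆U) ,
    trans (idle≡l∸h∸h Irigid σ L sound complete jstar-iff uR uL t l)
          (cong (l ∸ h l R t ∸_) (length-filter-takeAvoiding (inWindow? l t) U p≤∣U∣))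
    where
    L : List ℕ
    L = takeAvoiding (inWindow? l t) p U
    L⊆U : ∀ s → s ∈ L → s ∈ U
    L⊆U _ = takeAvoiding-⊆ (inWindow? l t) p U
    uL : Unique L
    uL = takeAvoiding-Unique (inWindow? l t) p uU
    σ : Schedule m
    σ = schedule Irigid L
    sound : ∀ k s → s ∈ lookup Irigid k → σ s ≡ just (rigid k)
    sound = schedule-rigid-sound Irigid L uR
    complete : ∀ k s → σ s ≡ just (rigid k) → s ∈ lookup Irigid k
    complete = schedule-rigid-complete Irigid L
    jstar-iff : ∀ s → (σ s ≡ just jstar) ⇔ (s ∈ L)
    jstar-iff = schedule-jstar Irigid L (λ (s∈L , s∈R) → U∩R=∅ (L⊆U _ s∈L , s∈R))

lemma8 : (l p m : ℕ) (Istar : List (List ℕ)) (Irigid : Vec (List ℕ) m) →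
    Unique (concat Istar ++ concat (toList Irigid)) →
    (∃ λ σ → Feasible m p Istar Irigid σ) →
    (t : ℕ) →
    IsG l m p Istar Irigid t
      (l ∸ sum (map (λ I → h l I t) (toList Irigid))
         ∸ (p ∸ (length (concat Istar) ∸ sum (map (λ I → h l I t) Istar))))
lemma8 l p m Istar Irigid unique-slots (_ , _ , _ , L₀ , uL₀ , ∣L₀∣≡p , _ , L₀⊆U) t
  rewrite sum-map-h l t (toList Irigid) | sum-map-h l t Istar =
  idle-attained l p Istar Irigid unique-slots t p≤∣U∣ ,
  idle-upper-bound l p Istar Irigid unique-slots t
  where
  p≤∣U∣ : p ≤ length (concat Istar)
  p≤∣U∣ = subst (_≤ length (concat Istar)) ∣L₀∣≡p (Unique∧⊆⇒length≤ uL₀ (L₀⊆U _))
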